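{- Let $\varepsilon>0$, let $G$ be a graph on $n$ vertices with $\delta(G)\ge(\tfrac12+\varepsilon)n$, and let $X=(V,E)$ be a graph such that $|V|=|E(G)|\le\binom n2$, $\Delta(X)\le\frac n2$ and $|E(X)|\ge\frac{\varepsilon}{800}n^3$. Let $S\subseteq V$ satisfy $|S|\le\frac{\varepsilon}{4000}n^2$ and $|N_X(S)|\le\frac{\varepsilon}{2000}n^2$. Then the set $A\subseteq V\setminus S$ of all $S$-useful vertices satisfies $|A|\ge\frac{\varepsilon}{4000}n^2$.
   Context: $N_X(S)$ denotes the set of vertices of $X$ outside $S$ having a neighbour in $S$. For $S\subseteq V$, a vertex $x\in V\setminus(S\cup N_X(S))$ is called $S$-useful if $|N_X(x)\setminus N_X(S)|\ge\frac{\varepsilon}{4000}n$.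
   Formalization: The parameter ε ranges over the positive rationals. -}

module Defs where

open import Data.Bool using (Bool; true; false; not; _∧_)
open import Data.Nat as ℕ using (ℕ; _<ᵇ_)
open import Data.Fin using (Fin; toℕ)
open import Data.Fin.Subset using (Subset; ∁; _∩_; _─_; ∣_∣)
open import Data.Vec using (tabulate; lookup)
open import Data.Integer using (+_)
open import Data.Rational using (ℚ; _/_)
open import Data.List using (List; map)
open import Data.Nat.ListAction using (sum)
open import Data.List.Base using (allFin)
open import Relation.Binary.PropositionalEquality using (_≡_)

record Graph (n : ℕ) : Set where
  field
    adj    : Fin n → Fin n → Bool
    sym    : ∀ i j → adj i j ≡ adj j i
    irrefl : ∀ i → adj i i ≡ false
open Graph public

ℕtoℚ : ℕ → ℚ
ℕtoℚ k = + k / 1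

nbr : ∀ {n} → Graph n → Fin n → Subset n
nbr X x = tabulate (adj X x)

deg : ∀ {n} → Graph n → Fin n → ℕ
deg X x = ∣ nbr X x ∣

edgeCount : ∀ {n} → Graph n → ℕ
edgeCount {n} X =
  sum (map (λ i → ∣ nbr X i ∩ tabulate (λ j → toℕ i <ᵇ toℕ j) ∣) (allFin n))

nbrSet : ∀ {n} → Graph n → Subset n → Subset n
nbrSet X S = ∁ S ∩ tabulate (λ y → 0 <ᵇ ∣ S ∩ nbr X y ∣)

usefulSet : ∀ {m} → Graph m → ℚ → ℕ → Subset m → Subset m
usefulSet X ε n S =
  tabulate (λ x →
    not (lookup S x) ∧ not (lookup (nbrSet X S) x) ∧
    Data.Rational._≤ᵇ_ (ε Data.Rational.* ((+ 1 / 4000) Data.Rational.* ℕtoℚ n))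
                       (ℕtoℚ ∣ nbr X x ─ nbrSet X S ∣))

-- Count the edges of X at their endpoints, splitting the neighbours of each
-- vertex x into those in N_X(S) and the new ones.  Edges into N_X(S) number at
-- most |N_X(S)|·n/2.  A vertex of S, of N_X(S) or of the useful set A has at most
-- n/2 new neighbours, any other vertex fewer than εn/4000, and there are at most
-- n²/2 vertices.  Hence εn³/800 ≤ e(X) ≤ (n/2)(|S| + 2|N_X(S)| + |A|) + εn³/8000,
-- and the bounds on |S| and |N_X(S)| leave |A| ≥ εn²/1000.

module Submission where

open import Defs hiding (sym)
open import Data.Bool using (Bool; true; false; not; _∧_; _∨_; T)
open import Data.Nat using (ℕ; zero; suc; _^_)
import Data.Nat as ℕ
import Data.Nat.Properties as ℕP
open import Data.Nat.Combinatorics using (_C_; nC1≡n; nCk+nC[k+1]≡[n+1]C[k+1])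
import Data.Nat.ListAction as ListAction
open import Data.Nat.Tactic.RingSolver as ℕSolver using ()
open import Data.Integer as ℤ using (+_)
import Data.Integer.Properties as ℤP
open import Data.Integer.Tactic.RingSolver as ℤSolver using ()
open import Data.Rational as ℚ using (ℚ; 0ℚ; 1ℚ; ½; _+_; _*_; _-_; _/_; _≤_; _<_; toℚᵘ)
import Data.Rational.Properties as ℚP
open import Data.Rational.Solver using (module +-*-Solver)
import Data.Rational.Unnormalised as ℚᵘ
import Data.Rational.Unnormalised.Properties as ℚᵘP
open import Data.Nat.Coprimality as Coprimality using (1-coprimeTo)
open import Data.Fin using (Fin; zero; suc; toℕ)
open import Data.Fin.Subset using (Subset; ∣_∣; _∩_; _∪_; _─_)
open import Data.Fin.Subset.Properties using (∣p∩q∣≤∣p∣; ∣p─q∣≤∣p∣; ∣p∣≤∣x∷p∣)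
import Data.List as List
import Data.List.Properties as List
open import Data.Vec using ([]; _∷_; lookup; tabulate)
import Data.Vec.Properties as Vec
open import Algebra.Properties.Semiring.Sum ℕP.+-*-semiring
  using (sum; sum-syntax; ∑-comm; ∑-distrib-+; sum-cong-≗; *-distribʳ-sum)
open import Data.Product using (_×_; _,_)
open import Function using (_∘_)
open import Relation.Binary.PropositionalEquality

-- The embedding ℕ → ℚ

toℚᵘ-ℕtoℚ : ∀ k → toℚᵘ (ℕtoℚ k) ≡ ℚᵘ.mkℚᵘ (+ k) 0
toℚᵘ-ℕtoℚ k = cong toℚᵘ (ℚP.normalize-coprime (Coprimality.sym (1-coprimeTo k)))

ℕtoℚ-homo-+ : ∀ a b → ℕtoℚ (a ℕ.+ b) ≡ ℕtoℚ a + ℕtoℚ b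
ℕtoℚ-homo-+ a b = ℚP.toℚᵘ-injective (begin
  toℚᵘ (ℕtoℚ (a ℕ.+ b))                 ≡⟨ toℚᵘ-ℕtoℚ (a ℕ.+ b) ⟩
  ℚᵘ.mkℚᵘ (+ (a ℕ.+ b)) 0               ≈⟨ ℚᵘ.*≡* (trans (cong (ℤ._* + 1) (ℤP.pos-+ a b)) (denominators-1 (+ a) (+ b))) ⟩
  ℚᵘ.mkℚᵘ (+ a) 0 ℚᵘ.+ ℚᵘ.mkℚᵘ (+ b) 0  ≡⟨ cong₂ ℚᵘ._+_ (toℚᵘ-ℕtoℚ a) (toℚᵘ-ℕtoℚ b) ⟨
  toℚᵘ (ℕtoℚ a) ℚᵘ.+ toℚᵘ (ℕtoℚ b)      ≈⟨ ℚP.toℚᵘ-homo-+ (ℕtoℚ a) (ℕtoℚ b) ⟨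
  toℚᵘ (ℕtoℚ a + ℕtoℚ b)                ∎)
  where
  open ℚᵘP.≃-Reasoning
  denominators-1 : ∀ x y → (x ℤ.+ y) ℤ.* + 1 ≡ (x ℤ.* + 1 ℤ.+ y ℤ.* + 1) ℤ.* + 1
  denominators-1 = ℤSolver.solve-∀

ℕtoℚ-homo-* : ∀ a b → ℕtoℚ (a ℕ.* b) ≡ ℕtoℚ a * ℕtoℚ b
ℕtoℚ-homo-* a b = ℚP.toℚᵘ-injective (begin
  toℚᵘ (ℕtoℚ (a ℕ.* b))                 ≡⟨ toℚᵘ-ℕtoℚ (a ℕ.* b) ⟩
  ℚᵘ.mkℚᵘ (+ (a ℕ.* b)) 0               ≈⟨ ℚᵘ.*≡* (cong (ℤ._* + 1) (ℤP.pos-* a b)) ⟩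
  ℚᵘ.mkℚᵘ (+ a) 0 ℚᵘ.* ℚᵘ.mkℚᵘ (+ b) 0  ≡⟨ cong₂ ℚᵘ._*_ (toℚᵘ-ℕtoℚ a) (toℚᵘ-ℕtoℚ b) ⟨
  toℚᵘ (ℕtoℚ a) ℚᵘ.* toℚᵘ (ℕtoℚ b)      ≈⟨ ℚP.toℚᵘ-homo-* (ℕtoℚ a) (ℕtoℚ b) ⟨
  toℚᵘ (ℕtoℚ a * ℕtoℚ b)                ∎)
  where open ℚᵘP.≃-Reasoning

*-nonNeg : ∀ {p q} → 0ℚ ≤ p → 0ℚ ≤ q → 0ℚ ≤ p * q
*-nonNeg {p} {q} 0≤p 0≤q = subst (_≤ p * q) (ℚP.*-zeroʳ p) (ℚP.*-monoˡ-≤-nonNeg p {{ℚ.nonNegative 0≤p}} 0≤q)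

ℕtoℚ-nonNeg : ∀ k → 0ℚ ≤ ℕtoℚ k
ℕtoℚ-nonNeg k = ℚP.nonNegative⁻¹ (ℕtoℚ k) {{ℚP.normalize-nonNeg k 1}}

ℕtoℚ-mono-≤ : ∀ {a b} → a ℕ.≤ b → ℕtoℚ a ≤ ℕtoℚ b
ℕtoℚ-mono-≤ {a} {b} a≤b = begin
  ℕtoℚ a                     ≡⟨ ℚP.+-identityʳ (ℕtoℚ a) ⟨
  ℕtoℚ a + 0ℚ                ≤⟨ ℚP.+-monoʳ-≤ (ℕtoℚ a) (ℕtoℚ-nonNeg (b ℕ.∸ a)) ⟩
  ℕtoℚ a + ℕtoℚ (b ℕ.∸ a)    ≡⟨ ℕtoℚ-homo-+ a (b ℕ.∸ a) ⟨
  ℕtoℚ (a ℕ.+ (b ℕ.∸ a))     ≡⟨ cong ℕtoℚ (ℕP.m+[n∸m]≡n a≤b) ⟩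
  ℕtoℚ b                     ∎
  where open ℚP.≤-Reasoning

ℕtoℚ-^2 : ∀ n → ℕtoℚ (n ^ 2) ≡ ℕtoℚ n * ℕtoℚ n
ℕtoℚ-^2 n = trans (ℕtoℚ-homo-* n (n ^ 1)) (cong (λ k → ℕtoℚ n * ℕtoℚ k) (ℕP.*-identityʳ n))

ℕtoℚ-^3 : ∀ n → ℕtoℚ (n ^ 3) ≡ ℕtoℚ n * (ℕtoℚ n * ℕtoℚ n)
ℕtoℚ-^3 n = trans (ℕtoℚ-homo-* n (n ^ 2)) (cong (ℕtoℚ n *_) (ℕtoℚ-^2 n))

-- Finite sums and cardinalities

∑-mono-≤ : ∀ {m} {f g : Fin m → ℕ} → (∀ i → f i ℕ.≤ g i) → ∑[ i < m ] f i ℕ.≤ ∑[ i < m ] g i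
∑-mono-≤ {zero}  f≤g = ℕ.z≤n
∑-mono-≤ {suc m} f≤g = ℕP.+-mono-≤ (f≤g zero) (∑-mono-≤ (f≤g ∘ suc))

sum-map-allFin : ∀ {m} (f : Fin m → ℕ) → ListAction.sum (List.map f (List.allFin m)) ≡ ∑[ i < m ] f i
sum-map-allFin {m} f = trans (cong ListAction.sum (List.map-tabulate (λ i → i) f)) (sum-tabulate f)
  where
  sum-tabulate : ∀ {k} (g : Fin k → ℕ) → ListAction.sum (List.tabulate g) ≡ ∑[ i < k ] g i
  sum-tabulate {zero}  g = refl
  sum-tabulate {suc k} g = cong (g zero ℕ.+_) (sum-tabulate (g ∘ suc))

𝟙 : Bool → ℕ
𝟙 true  = 1
𝟙 false = 0

𝟙-∧ : ∀ a b → 𝟙 (a ∧ b) ≡ 𝟙 a ℕ.* 𝟙 b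
𝟙-∧ true  b = sym (ℕP.+-identityʳ (𝟙 b))
𝟙-∧ false b = refl

∣p∣≡∑𝟙 : ∀ {m} (p : Subset m) → ∣ p ∣ ≡ ∑[ i < m ] 𝟙 (lookup p i)
∣p∣≡∑𝟙 []          = refl
∣p∣≡∑𝟙 (true  ∷ p) = cong suc (∣p∣≡∑𝟙 p)
∣p∣≡∑𝟙 (false ∷ p) = ∣p∣≡∑𝟙 p

∣p∣≡∣p∩q∣+∣p─q∣ : ∀ {m} (p q : Subset m) → ∣ p ∣ ≡ ∣ p ∩ q ∣ ℕ.+ ∣ p ─ q ∣
∣p∣≡∣p∩q∣+∣p─q∣ []          []          = refl
∣p∣≡∣p∩q∣+∣p─q∣ (true  ∷ p) (true  ∷ q) = cong suc (∣p∣≡∣p∩q∣+∣p─q∣ p q)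
∣p∣≡∣p∩q∣+∣p─q∣ (true  ∷ p) (false ∷ q) = trans (cong suc (∣p∣≡∣p∩q∣+∣p─q∣ p q)) (sym (ℕP.+-suc _ _))
∣p∣≡∣p∩q∣+∣p─q∣ (false ∷ p) (true  ∷ q) = ∣p∣≡∣p∩q∣+∣p─q∣ p q
∣p∣≡∣p∩q∣+∣p─q∣ (false ∷ p) (false ∷ q) = ∣p∣≡∣p∩q∣+∣p─q∣ p q

∣p∪q∣≤∣p∣+∣q∣ : ∀ {m} (p q : Subset m) → ∣ p ∪ q ∣ ℕ.≤ ∣ p ∣ ℕ.+ ∣ q ∣
∣p∪q∣≤∣p∣+∣q∣ []          []          = ℕ.z≤n
∣p∪q∣≤∣p∣+∣q∣ (true  ∷ p) (x     ∷ q) = ℕ.s≤s (ℕP.≤-trans (∣p∪q∣≤∣p∣+∣q∣ p q) (ℕP.+-monoʳ-≤ ∣ p ∣ (∣p∣≤∣x∷p∣ x q)))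
∣p∪q∣≤∣p∣+∣q∣ (false ∷ p) (true  ∷ q) = ℕP.≤-trans (ℕ.s≤s (∣p∪q∣≤∣p∣+∣q∣ p q)) (ℕP.≤-reflexive (sym (ℕP.+-suc ∣ p ∣ ∣ q ∣)))
∣p∪q∣≤∣p∣+∣q∣ (false ∷ p) (false ∷ q) = ∣p∪q∣≤∣p∣+∣q∣ p q

lookup-∪-false : ∀ {m} (p q : Subset m) i → lookup (p ∪ q) i ≡ false → lookup p i ≡ false × lookup q i ≡ false
lookup-∪-false p q i eq = ∨-false (trans (sym (Vec.lookup-zipWith _∨_ i p q)) eq)
  where
  ∨-false : ∀ {a b} → a ∨ b ≡ false → a ≡ false × b ≡ false
  ∨-false {false} b≡false = refl , b≡false

ℕtoℚ-∑-≤ : ∀ {m} (P : Subset m) (f : Fin m → ℕ) {D c : ℚ} → 0ℚ ≤ c →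
           (∀ i → lookup P i ≡ true → ℕtoℚ (f i) ≤ D) →
           (∀ i → lookup P i ≡ false → ℕtoℚ (f i) ≤ c) →
           ℕtoℚ (∑[ i < m ] f i) ≤ ℕtoℚ ∣ P ∣ * D + ℕtoℚ m * c
ℕtoℚ-∑-≤ [] f {D} {c} _ _ _ = ℚP.≤-reflexive (sym (trans (cong₂ _+_ (ℚP.*-zeroˡ D) (ℚP.*-zeroˡ c)) (ℚP.+-identityʳ 0ℚ)))
ℕtoℚ-∑-≤ {suc m} (true ∷ P) f {D} {c} 0≤c onP offP = begin
  ℕtoℚ (f zero ℕ.+ ∑[ i < m ] f (suc i))     ≡⟨ ℕtoℚ-homo-+ (f zero) _ ⟩
  ℕtoℚ (f zero) + ℕtoℚ (∑[ i < m ] f (suc i)) ≤⟨ ℚP.+-mono-≤ (onP zero refl) (ℕtoℚ-∑-≤ P (f ∘ suc) 0≤c (onP ∘ suc) (offP ∘ suc)) ⟩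
  D + (p * D + ℕtoℚ m * c)                    ≤⟨ ℚP.+-monoʳ-≤ D (ℚP.+-monoʳ-≤ (p * D) (ℚP.*-monoʳ-≤-nonNeg c {{ℚ.nonNegative 0≤c}} (ℕtoℚ-mono-≤ (ℕP.n≤1+n m)))) ⟩
  D + (p * D + ℕtoℚ (suc m) * c)              ≡⟨ solve 3 (λ D p q → D :+ (p :* D :+ q) := (con 1ℚ :+ p) :* D :+ q) refl D p (ℕtoℚ (suc m) * c) ⟩
  (1ℚ + p) * D + ℕtoℚ (suc m) * c             ≡⟨ cong (λ x → x * D + ℕtoℚ (suc m) * c) (ℕtoℚ-homo-+ 1 ∣ P ∣) ⟨
  ℕtoℚ (suc ∣ P ∣) * D + ℕtoℚ (suc m) * c     ∎
  where
  open ℚP.≤-Reasoning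
  open +-*-Solver
  p = ℕtoℚ ∣ P ∣
ℕtoℚ-∑-≤ {suc m} (false ∷ P) f {D} {c} 0≤c onP offP = begin
  ℕtoℚ (f zero ℕ.+ ∑[ i < m ] f (suc i))     ≡⟨ ℕtoℚ-homo-+ (f zero) _ ⟩
  ℕtoℚ (f zero) + ℕtoℚ (∑[ i < m ] f (suc i)) ≤⟨ ℚP.+-mono-≤ (offP zero refl) (ℕtoℚ-∑-≤ P (f ∘ suc) 0≤c (onP ∘ suc) (offP ∘ suc)) ⟩
  c + (p * D + ℕtoℚ m * c)                    ≡⟨ solve 4 (λ D c p q → c :+ (p :* D :+ q :* c) := p :* D :+ (con 1ℚ :+ q) :* c) refl D c p (ℕtoℚ m) ⟩
  p * D + (1ℚ + ℕtoℚ m) * c                   ≡⟨ cong (λ x → p * D + x * c) (ℕtoℚ-homo-+ 1 m) ⟨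
  p * D + ℕtoℚ (suc m) * c                    ∎
  where
  open ℚP.≤-Reasoning
  open +-*-Solver
  p = ℕtoℚ ∣ P ∣

-- Double counting in a graph

module _ {m} (X : Graph m) where

  lookup-nbr : ∀ x y → lookup (nbr X x) y ≡ adj X x y
  lookup-nbr x = Vec.lookup∘tabulate (adj X x)

  edgeCount≤∑deg : edgeCount X ℕ.≤ ∑[ x < m ] deg X x
  edgeCount≤∑deg = begin
    edgeCount X                                ≡⟨ sum-map-allFin (λ i → ∣ nbr X i ∩ later i ∣) ⟩
    ∑[ x < m ] ∣ nbr X x ∩ later x ∣           ≤⟨ ∑-mono-≤ (λ x → ∣p∩q∣≤∣p∣ (nbr X x) (later x)) ⟩
    ∑[ x < m ] deg X x                         ∎
    where
    open ℕP.≤-Reasoning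
    later : Fin m → Subset m
    later i = tabulate (λ j → toℕ i ℕ.<ᵇ toℕ j)

  ∑∣nbr∩T∣≡∑deg : ∀ T → ∑[ x < m ] ∣ nbr X x ∩ T ∣ ≡ ∑[ y < m ] (deg X y ℕ.* 𝟙 (lookup T y))
  ∑∣nbr∩T∣≡∑deg T = begin
    ∑[ x < m ] ∣ nbr X x ∩ T ∣                                 ≡⟨ sum-cong-≗ (λ x → trans (∣p∣≡∑𝟙 (nbr X x ∩ T)) (sum-cong-≗ (entry x))) ⟩
    ∑[ x < m ] ∑[ y < m ] (𝟙 (adj X y x) ℕ.* 𝟙 (lookup T y))   ≡⟨ ∑-comm (λ x y → 𝟙 (adj X y x) ℕ.* 𝟙 (lookup T y)) ⟩
    ∑[ y < m ] ∑[ x < m ] (𝟙 (adj X y x) ℕ.* 𝟙 (lookup T y))   ≡⟨ sum-cong-≗ (λ y → *-distribʳ-sum (𝟙 (lookup T y)) (𝟙 ∘ adj X y)) ⟨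
    ∑[ y < m ] ((∑[ x < m ] 𝟙 (adj X y x)) ℕ.* 𝟙 (lookup T y)) ≡⟨ sum-cong-≗ (λ y → cong (ℕ._* 𝟙 (lookup T y)) (deg≡∑ y)) ⟨
    ∑[ y < m ] (deg X y ℕ.* 𝟙 (lookup T y))                     ∎
    where
    open ≡-Reasoning
    entry : ∀ x y → 𝟙 (lookup (nbr X x ∩ T) y) ≡ 𝟙 (adj X y x) ℕ.* 𝟙 (lookup T y)
    entry x y = begin
      𝟙 (lookup (nbr X x ∩ T) y)         ≡⟨ cong 𝟙 (Vec.lookup-zipWith _∧_ y (nbr X x) T) ⟩
      𝟙 (lookup (nbr X x) y ∧ lookup T y) ≡⟨ cong (λ b → 𝟙 (b ∧ lookup T y)) (trans (lookup-nbr x y) (Graph.sym X x y)) ⟩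
      𝟙 (adj X y x ∧ lookup T y)          ≡⟨ 𝟙-∧ (adj X y x) (lookup T y) ⟩
      𝟙 (adj X y x) ℕ.* 𝟙 (lookup T y)   ∎
    deg≡∑ : ∀ y → deg X y ≡ ∑[ x < m ] 𝟙 (adj X y x)
    deg≡∑ y = trans (∣p∣≡∑𝟙 (nbr X y)) (sum-cong-≗ (cong 𝟙 ∘ lookup-nbr y))

-- Edges of X around S

module _ {m} (X : Graph m) (ε : ℚ) (n : ℕ) (S : Subset m) where

  private
    ∂S = nbrSet X S
    A  = usefulSet X ε n S
    c  = ε * ((+ 1 / 4000) * ℕtoℚ n)
    s  = ℕtoℚ ∣ S ∣
    t  = ℕtoℚ ∣ ∂S ∣
    a  = ℕtoℚ ∣ A ∣

  lookup-usefulSet : ∀ x → lookup A x ≡ (not (lookup S x) ∧ not (lookup ∂S x) ∧ (c ℚ.≤ᵇ ℕtoℚ ∣ nbr X x ─ ∂S ∣))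
  lookup-usefulSet x = Vec.lookup∘tabulate (λ y → not (lookup S y) ∧ not (lookup ∂S y) ∧ (c ℚ.≤ᵇ ℕtoℚ ∣ nbr X y ─ ∂S ∣)) x

  few-new-neighbours : ∀ x → lookup (S ∪ ∂S ∪ A) x ≡ false → ℕtoℚ ∣ nbr X x ─ ∂S ∣ ≤ c
  few-new-neighbours x outside = ℚP.<⇒≤ (ℚP.≰⇒> (λ c≤new → subst T not-useful (ℚP.≤⇒≤ᵇ c≤new)))
    where
    not-useful : (c ℚ.≤ᵇ ℕtoℚ ∣ nbr X x ─ ∂S ∣) ≡ false
    not-useful =
      let x∉S , x∉∂S∪A = lookup-∪-false S (∂S ∪ A) x outside
          x∉∂S , x∉A  = lookup-∪-false ∂S A x x∉∂S∪A
      in trans (sym (cong₂ (λ s b → not s ∧ not b ∧ (c ℚ.≤ᵇ ℕtoℚ ∣ nbr X x ─ ∂S ∣)) x∉S x∉∂S))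
               (trans (sym (lookup-usefulSet x)) x∉A)

  edgeCount-≤ : 0ℚ ≤ ε → {D : ℚ} → 0ℚ ≤ D → (∀ x → ℕtoℚ (deg X x) ≤ D) →
                ℕtoℚ (edgeCount X) ≤ (t + (s + (t + a))) * D + ℕtoℚ m * c
  edgeCount-≤ 0≤ε {D} 0≤D deg≤D = begin
    ℕtoℚ (edgeCount X)                          ≤⟨ ℕtoℚ-mono-≤ (ℕP.≤-trans (edgeCount≤∑deg X) (ℕP.≤-reflexive ∑deg≡∑old+∑new)) ⟩
    ℕtoℚ (∑old ℕ.+ ∑new)                        ≡⟨ ℕtoℚ-homo-+ ∑old ∑new ⟩
    ℕtoℚ ∑old + ℕtoℚ ∑new                       ≤⟨ ℚP.+-mono-≤ old-bound new-bound ⟩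
    t * D + (ℕtoℚ outside * D + ℕtoℚ m * c)     ≡⟨ cong (λ q → t * D + (q * D + ℕtoℚ m * c)) ℕtoℚ-outside ⟩
    t * D + ((s + (t + a)) * D + ℕtoℚ m * c)    ≡⟨ solve 5 (λ t u D M c → t :* D :+ (u :* D :+ M :* c) := (t :+ u) :* D :+ M :* c)
                                                          refl t (s + (t + a)) D (ℕtoℚ m) c ⟩
    (t + (s + (t + a))) * D + ℕtoℚ m * c        ∎
    where
    open ℚP.≤-Reasoning
    open +-*-Solver
    ∑old = ∑[ x < m ] ∣ nbr X x ∩ ∂S ∣
    ∑new = ∑[ x < m ] ∣ nbr X x ─ ∂S ∣
    outside = ∣ S ∣ ℕ.+ (∣ ∂S ∣ ℕ.+ ∣ A ∣)
    ℕtoℚ-outside : ℕtoℚ outside ≡ s + (t + a)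
    ℕtoℚ-outside = trans (ℕtoℚ-homo-+ ∣ S ∣ _) (cong (_+_ s) (ℕtoℚ-homo-+ ∣ ∂S ∣ ∣ A ∣))

    ∑deg≡∑old+∑new : ∑[ x < m ] deg X x ≡ ∑old ℕ.+ ∑new
    ∑deg≡∑old+∑new = trans (sum-cong-≗ (λ x → ∣p∣≡∣p∩q∣+∣p─q∣ (nbr X x) ∂S)) (∑-distrib-+ (λ x → ∣ nbr X x ∩ ∂S ∣) (λ x → ∣ nbr X x ─ ∂S ∣))

    old-bound : ℕtoℚ ∑old ≤ t * D
    old-bound = begin
      ℕtoℚ ∑old                                             ≡⟨ cong ℕtoℚ (∑∣nbr∩T∣≡∑deg X ∂S) ⟩
      ℕtoℚ (∑[ y < m ] (deg X y ℕ.* 𝟙 (lookup ∂S y)))       ≤⟨ ℕtoℚ-∑-≤ ∂S _ ℚP.≤-refl on-∂S off-∂S ⟩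
      t * D + ℕtoℚ m * 0ℚ                                   ≡⟨ trans (cong (_+_ (t * D)) (ℚP.*-zeroʳ (ℕtoℚ m))) (ℚP.+-identityʳ (t * D)) ⟩
      t * D                                                 ∎
      where
      on-∂S : ∀ y → lookup ∂S y ≡ true → ℕtoℚ (deg X y ℕ.* 𝟙 (lookup ∂S y)) ≤ D
      on-∂S y y∈∂S rewrite y∈∂S | ℕP.*-identityʳ (deg X y) = deg≤D y
      off-∂S : ∀ y → lookup ∂S y ≡ false → ℕtoℚ (deg X y ℕ.* 𝟙 (lookup ∂S y)) ≤ 0ℚ
      off-∂S y y∉∂S rewrite y∉∂S | ℕP.*-zeroʳ (deg X y) = ℚP.≤-refl

    new-bound : ℕtoℚ ∑new ≤ ℕtoℚ outside * D + ℕtoℚ m * c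
    new-bound = begin
      ℕtoℚ ∑new                                   ≤⟨ ℕtoℚ-∑-≤ (S ∪ ∂S ∪ A) _ 0≤c (λ x _ → ℚP.≤-trans (ℕtoℚ-mono-≤ (∣p─q∣≤∣p∣ (nbr X x) ∂S)) (deg≤D x)) few-new-neighbours ⟩
      ℕtoℚ ∣ S ∪ ∂S ∪ A ∣ * D + ℕtoℚ m * c        ≤⟨ ℚP.+-monoˡ-≤ (ℕtoℚ m * c) (ℚP.*-monoʳ-≤-nonNeg D {{ℚ.nonNegative 0≤D}} (ℕtoℚ-mono-≤ ∣S∪∂S∪A∣≤)) ⟩
      ℕtoℚ outside * D + ℕtoℚ m * c               ∎
      where
      0≤c : 0ℚ ≤ c
      0≤c = *-nonNeg 0≤ε (*-nonNeg {+ 1 / 4000} (ℚP.≤ᵇ⇒≤ _) (ℕtoℚ-nonNeg n))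
      ∣S∪∂S∪A∣≤ : ∣ S ∪ ∂S ∪ A ∣ ℕ.≤ outside
      ∣S∪∂S∪A∣≤ = ℕP.≤-trans (∣p∪q∣≤∣p∣+∣q∣ S (∂S ∪ A)) (ℕP.+-monoʳ-≤ ∣ S ∣ (∣p∪q∣≤∣p∣+∣q∣ ∂S A))

2*nC2≤n^2 : ∀ n → 2 ℕ.* (n C 2) ℕ.≤ n ^ 2
2*nC2≤n^2 zero    = ℕ.z≤n
2*nC2≤n^2 (suc k) = begin
  2 ℕ.* (suc k C 2)         ≡⟨ cong (2 ℕ.*_) pascal ⟨
  2 ℕ.* (k ℕ.+ k C 2)       ≡⟨ ℕP.*-distribˡ-+ 2 k (k C 2) ⟩
  2 ℕ.* k ℕ.+ 2 ℕ.* (k C 2) ≤⟨ ℕP.+-monoʳ-≤ (2 ℕ.* k) (2*nC2≤n^2 k) ⟩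
  2 ℕ.* k ℕ.+ k ^ 2         <⟨ ℕP.n<1+n _ ⟩
  suc (2 ℕ.* k ℕ.+ k ^ 2)   ≡⟨ square-suc k ⟩
  suc k ^ 2                 ∎
  where
  open ℕP.≤-Reasoning
  pascal : k ℕ.+ k C 2 ≡ suc k C 2
  pascal = trans (cong (ℕ._+ k C 2) (sym (nC1≡n k))) (nCk+nC[k+1]≡[n+1]C[k+1] k 1)
  square-suc : ∀ k → suc (2 ℕ.* k ℕ.+ k ℕ.* (k ℕ.* 1)) ≡ suc k ℕ.* (suc k ℕ.* 1)
  square-suc = ℕSolver.solve-∀

2*a≤b⇒ℕtoℚ[a]≤½*ℕtoℚ[b] : ∀ {a b} → 2 ℕ.* a ℕ.≤ b → ℕtoℚ a ≤ ½ * ℕtoℚ b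
2*a≤b⇒ℕtoℚ[a]≤½*ℕtoℚ[b] {a} {b} 2a≤b = begin
  ℕtoℚ a                  ≡⟨ solve 1 (λ x → x := con ½ :* (con (ℕtoℚ 2) :* x)) refl (ℕtoℚ a) ⟩
  ½ * (ℕtoℚ 2 * ℕtoℚ a)   ≡⟨ cong (½ *_) (ℕtoℚ-homo-* 2 a) ⟨
  ½ * ℕtoℚ (2 ℕ.* a)      ≤⟨ ℚP.*-monoˡ-≤-nonNeg ½ (ℕtoℚ-mono-≤ 2a≤b) ⟩
  ½ * ℕtoℚ b              ∎
  where
  open ℚP.≤-Reasoning
  open +-*-Solver

useful-lower-bound-pos : ∀ (ε N s t a M : ℚ) → 0ℚ ≤ ε → 0ℚ < N →
                         s ≤ ε * ((+ 1 / 4000) * (N * N)) → t ≤ ε * ((+ 1 / 2000) * (N * N)) → M ≤ ½ * (N * N) →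
                         ε * ((+ 1 / 800) * (N * (N * N))) ≤ (t + (s + (t + a))) * (½ * N) + M * (ε * ((+ 1 / 4000) * N)) →
                         ε * ((+ 1 / 4000) * (N * N)) ≤ a
useful-lower-bound-pos ε N s t a M 0≤ε 0<N s≤E t≤2E M≤ edges≤ = begin
  E                                                    ≡⟨ ℚP.+-identityʳ E ⟨
  E + 0ℚ                                               ≤⟨ ℚP.+-monoʳ-≤ E (*-nonNeg {+ 3 / 1} (ℚP.≤ᵇ⇒≤ _) 0≤E) ⟩
  E + (+ 3 / 1) * E                                    ≡⟨ solve 1 (λ E → E :+ con (+ 3 / 1) :* E := con (+ 2 / 1) :* (con (+ 5 / 1) :* E) :- con (+ 6 / 1) :* E) refl E ⟩
  (+ 2 / 1) * ((+ 5 / 1) * E) - (+ 6 / 1) * E          ≤⟨ ℚP.+-monoˡ-≤ (ℚ.- ((+ 6 / 1) * E)) (ℚP.*-monoˡ-≤-nonNeg (+ 2 / 1) 5E≤) ⟩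
  (+ 2 / 1) * ((+ 3 / 1) * E + ½ * a) - (+ 6 / 1) * E  ≡⟨ solve 2 (λ E a → con (+ 2 / 1) :* (con (+ 3 / 1) :* E :+ con ½ :* a) :- con (+ 6 / 1) :* E := a) refl E a ⟩
  a                                                    ∎
  where
  open ℚP.≤-Reasoning
  open +-*-Solver
  E = ε * ((+ 1 / 4000) * (N * N))
  c = ε * ((+ 1 / 4000) * N)
  0≤N : 0ℚ ≤ N
  0≤N = ℚP.<⇒≤ 0<N
  0≤E : 0ℚ ≤ E
  0≤E = *-nonNeg 0≤ε (*-nonNeg {+ 1 / 4000} (ℚP.≤ᵇ⇒≤ _) (*-nonNeg 0≤N 0≤N))
  0≤c : 0ℚ ≤ c
  0≤c = *-nonNeg 0≤ε (*-nonNeg {+ 1 / 4000} (ℚP.≤ᵇ⇒≤ _) 0≤N)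
  0≤½N : 0ℚ ≤ ½ * N
  0≤½N = *-nonNeg {½} (ℚP.≤ᵇ⇒≤ _) 0≤N
  2E = ε * ((+ 1 / 2000) * (N * N))
  5E≤ : (+ 5 / 1) * E ≤ (+ 3 / 1) * E + ½ * a
  5E≤ = ℚP.*-cancelˡ-≤-pos N {{ℚ.positive 0<N}} (begin
    N * ((+ 5 / 1) * E)                                    ≡⟨ solve 2 (λ ε N → N :* (con (+ 5 / 1) :* (ε :* (con (+ 1 / 4000) :* (N :* N))))
                                                                     := ε :* (con (+ 1 / 800) :* (N :* (N :* N)))) refl ε N ⟩
    ε * ((+ 1 / 800) * (N * (N * N)))                      ≤⟨ edges≤ ⟩
    (t + (s + (t + a))) * (½ * N) + M * c                  ≤⟨ ℚP.+-mono-≤ (ℚP.*-monoʳ-≤-nonNeg (½ * N) {{ℚ.nonNegative 0≤½N}}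
                                                                              (ℚP.+-mono-≤ t≤2E (ℚP.+-mono-≤ s≤E (ℚP.+-monoˡ-≤ a t≤2E))))
                                                                           (ℚP.*-monoʳ-≤-nonNeg c {{ℚ.nonNegative 0≤c}} M≤) ⟩
    (2E + (E + (2E + a))) * (½ * N) + ½ * (N * N) * c      ≡⟨ solve 3 (λ ε N a →
                                                                 (ε :* (con (+ 1 / 2000) :* (N :* N)) :+ (ε :* (con (+ 1 / 4000) :* (N :* N)) :+ (ε :* (con (+ 1 / 2000) :* (N :* N)) :+ a))) :* (con ½ :* N)
                                                                   :+ con ½ :* (N :* N) :* (ε :* (con (+ 1 / 4000) :* N))
                                                                 := N :* (con (+ 3 / 1) :* (ε :* (con (+ 1 / 4000) :* (N :* N))) :+ con ½ :* a)) refl ε N a ⟩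
    N * ((+ 3 / 1) * E + ½ * a)                            ∎)

useful-lower-bound : ∀ ε n {s t a M : ℚ} → 0ℚ ≤ ε → 0ℚ ≤ a →
                     s ≤ ε * ((+ 1 / 4000) * ℕtoℚ (n ^ 2)) → t ≤ ε * ((+ 1 / 2000) * ℕtoℚ (n ^ 2)) → M ≤ ½ * ℕtoℚ (n ^ 2) →
                     ε * ((+ 1 / 800) * ℕtoℚ (n ^ 3)) ≤ (t + (s + (t + a))) * (½ * ℕtoℚ n) + M * (ε * ((+ 1 / 4000) * ℕtoℚ n)) →
                     ε * ((+ 1 / 4000) * ℕtoℚ (n ^ 2)) ≤ a
useful-lower-bound ε zero {a = a} _ 0≤a _ _ _ _ =
  subst (_≤ a) (sym (trans (cong (ε *_) (ℚP.*-zeroʳ (+ 1 / 4000))) (ℚP.*-zeroʳ ε))) 0≤a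
useful-lower-bound ε n@(suc _) {s} {t} {a} {M} 0≤ε _ s≤ t≤ M≤ edges≤ =
  subst (λ q → ε * ((+ 1 / 4000) * q) ≤ a) (sym n²≡)
    (useful-lower-bound-pos ε N s t a M 0≤ε (ℚP.positive⁻¹ N {{ℚP.normalize-pos n 1}})
      (subst (λ q → s ≤ ε * ((+ 1 / 4000) * q)) n²≡ s≤)
      (subst (λ q → t ≤ ε * ((+ 1 / 2000) * q)) n²≡ t≤)
      (subst (λ q → M ≤ ½ * q) n²≡ M≤)
      (subst (λ q → ε * ((+ 1 / 800) * q) ≤ (t + (s + (t + a))) * (½ * N) + M * (ε * ((+ 1 / 4000) * N))) (ℕtoℚ-^3 n) edges≤))
  where
  N = ℕtoℚ n
  n²≡ = ℕtoℚ-^2 n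

lemma3p7 : (ε : ℚ) → 0ℚ < ε → (n : ℕ) → (G : Graph n) →
    (∀ v → (½ + ε) * ℕtoℚ n ≤ ℕtoℚ (deg G v)) →
    (X : Graph (edgeCount G)) →
    Data.Nat._≤_ (edgeCount G) (n C 2) →
    (∀ x → ℕtoℚ (deg X x) ≤ ½ * ℕtoℚ n) →
    ε * ((+ 1 / 800) * ℕtoℚ (n ^ 3)) ≤ ℕtoℚ (edgeCount X) →
    (S : Subset (edgeCount G)) →
    ℕtoℚ ∣ S ∣ ≤ ε * ((+ 1 / 4000) * ℕtoℚ (n ^ 2)) →
    ℕtoℚ ∣ nbrSet X S ∣ ≤ ε * ((+ 1 / 2000) * ℕtoℚ (n ^ 2)) →
    ε * ((+ 1 / 4000) * ℕtoℚ (n ^ 2)) ≤ ℕtoℚ ∣ usefulSet X ε n S ∣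
lemma3p7 ε 0<ε n G _ X m≤nC2 deg≤ edges≥ S s≤ t≤ =
  useful-lower-bound ε n 0≤ε (ℕtoℚ-nonNeg ∣ usefulSet X ε n S ∣) s≤ t≤ m≤½n²
    (ℚP.≤-trans edges≥ (edgeCount-≤ X ε n S 0≤ε 0≤½n deg≤))
  where
  0≤ε : 0ℚ ≤ ε
  0≤ε = ℚP.<⇒≤ 0<ε
  0≤½n : 0ℚ ≤ ½ * ℕtoℚ n
  0≤½n = *-nonNeg {½} (ℚP.≤ᵇ⇒≤ _) (ℕtoℚ-nonNeg n)
  m≤½n² : ℕtoℚ (edgeCount G) ≤ ½ * ℕtoℚ (n ^ 2)
  m≤½n² = 2*a≤b⇒ℕtoℚ[a]≤½*ℕtoℚ[b] {edgeCount G} (ℕP.≤-trans (ℕP.*-monoʳ-≤ 2 m≤nC2) (2*nC2≤n^2 n))
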